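{- Let $A$ be the $3\times 4$ matrix $$A=\begin{bmatrix}1&1&1&1\\1&1&1&1\\1&0&0&0\end{bmatrix}.$$ For every integer $k\geq 1$ there exists an integer $m\leq 64k+1$ such that $$\mathrm{forb}(m,A)\geq \frac{5}{3}\binom{m}{2}+\binom{m}{1}+\binom{m}{0}+k.$$
   Context: A $0$-$1$ matrix is simple if it has no repeated columns; an $m\times n$ simple $0$-$1$ matrix corresponds to a family of $n$ distinct subsets of $[m]$ (rows index elements, columns index sets). A matrix $M$ has configuration $F$ if some submatrix of $M$ is a row and column permutation of $F$. For a $0$-$1$ matrix $F$, $\mathrm{forb}(m,F)$ denotes the maximum number of columns of an $m$-rowed simple $0$-$1$ matrix that does not have configuration $F$. -}

module Defs where

open import Data.Nat using (ℕ; _≤_)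
open import Data.Fin using (Fin; zero; suc)
open import Data.Bool using (Bool; true; false)
open import Data.Product using (Σ; ∃; _×_; _,_)
open import Relation.Binary.PropositionalEquality using (_≡_)
open import Relation.Nullary using (¬_)
open import Function.Definitions using (Injective)

Matrix : ℕ → ℕ → Set
Matrix m n = Fin m → Fin n → Bool

Simple : ∀ {m n} → Matrix m n → Set
Simple {m} M = ∀ i j → (∀ (r : Fin m) → M r i ≡ M r j) → i ≡ j

-- M has configuration F: some submatrix of M is a row and column permutation
-- of F, i.e. there are injective row and column selections f, g with
-- M (f r) (g c) = F r c for all rows r and columns c of F.
HasConfig : ∀ {m n p q} → Matrix m n → Matrix p q → Set
HasConfig {m} {n} {p} {q} M F =
  Σ (Fin p → Fin m) λ f → Σ (Fin q → Fin n) λ g →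
    Injective _≡_ _≡_ f × Injective _≡_ _≡_ g × (∀ r c → M (f r) (g c) ≡ F r c)

IsForb : ∀ {p q} → ℕ → Matrix p q → ℕ → Set
IsForb m F N =
  (Σ (Matrix m N) λ M → Simple M × ¬ HasConfig M F)
  × (∀ n (M : Matrix m n) → Simple M → ¬ HasConfig M F → n ≤ N)

A : Matrix 3 4
A zero c = true
A (suc zero) c = true
A (suc (suc zero)) zero = true
A (suc (suc zero)) (suc c) = false

module Submission where

-- The lower bound comes from an explicit construction over the affine space
-- AG(j,4) with m = 4^j points.  The rows are the points, and the columns are
-- the empty set, the m singletons, and for each of the b_j = C(m,2)/6 lines
-- all 11 of its subsets with at least two points; so forb(m,A) ≥ 1 + m + 11 b_j,
-- which is (5/3) C(m,2) + m + 1 + b_j.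
--
-- The family avoids A: a column containing two points lies inside a unique
-- line, so the rows a,b,c of a copy of A lie on one line ℓ (they share the first
-- column), and the other three columns are subsets of ℓ containing a,b and not
-- c.  Such a subset is determined by whether it contains the fourth point of ℓ,
-- so there are only two of them.

open import Defs
open import Data.Nat using (ℕ; zero; suc; _≤_; _+_; _*_; _^_; _≤?_; s≤s⁻¹)
open import Data.Nat.Properties
  using (≤-refl; ≤-trans; ≤-antisym; ≰⇒>; n≤1+n; m≤m+n; m≤n+m; m^n>0;
         +-comm; *-assoc; *-identityʳ; +-mono-≤; +-monoʳ-≤; *-mono-≤; *-monoʳ-≤;
         *-monoˡ-≤; +-cancelʳ-≡; *-cancelˡ-≡; module ≤-Reasoning)
open import Data.Nat.Combinatorics using (_C_; nC1≡n; nCk+nC[k+1]≡[n+1]C[k+1])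
open import Data.Nat.Tactic.RingSolver using (solve-∀)
open import Data.Fin using (Fin; zero; suc)
open import Data.Fin.Properties using (_≟_; all?; any?; 0↔⊥; 1↔⊤; +↔⊎; *↔×)
open import Data.Vec using (Vec; []; _∷_; lookup; zipWith)
open import Data.Vec.Properties using (∷-injectiveˡ; ∷-injectiveʳ; ≡-dec)
open import Data.Bool using (Bool; true; false)
import Data.Bool.Properties as Bool
open import Data.Product using (Σ; ∃; ∃₂; _×_; _,_; proj₁; proj₂)
open import Data.Product.Function.NonDependent.Propositional using (_×-↔_)
open import Data.Sum using (_⊎_; inj₁; inj₂)
open import Data.Sum.Function.Propositional using (_⊎-↔_)
open import Data.Unit using (⊤; tt)
open import Data.Empty using (⊥; ⊥-elim)
open import Function.Bundles using (_↔_; mk↔ₛ′; mk⇔; Inverse; Injection)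
open import Function.Base using (_∘_)
open import Function.Definitions using (Injective)
open import Function.Properties.Inverse using (↔-refl; ↔-trans; ↔⇒↣)
open import Relation.Nullary using (¬_; Dec; yes; no; does)
open import Relation.Nullary.Decidable
  using (_×-dec_; _⊎-dec_; _→-dec_; ¬?; from-yes; dec-true)
open import Relation.Binary.PropositionalEquality
  using (_≡_; refl; sym; trans; cong; cong₂; subst; module ≡-Reasoning)

-- From set systems to lower bounds for forb

forb-lowerBound : ∀ {p q m n N} {R C : Set} (F : Matrix p q)
  (rows : Fin m ↔ R) (cols : Fin n ↔ C) (incidence : C → R → Bool) →
  (∀ X Y → (∀ x → incidence X x ≡ incidence Y x) → X ≡ Y) →
  (∀ (f : Fin p → R) (g : Fin q → C) → Injective _≡_ _≡_ f → Injective _≡_ _≡_ g →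
     (∀ r c → incidence (g c) (f r) ≡ F r c) → ⊥) →
  IsForb m F N → n ≤ N
forb-lowerBound {m = m} {n = n} {R = R} {C = C} F rows cols incidence separated avoids (_ , maximal) =
  maximal n M simple noConfig
  where
  row : Fin m → R
  row = Inverse.to rows
  col : Fin n → C
  col = Inverse.to cols
  row-inj : Injective _≡_ _≡_ row
  row-inj = Injection.injective (↔⇒↣ rows)
  col-inj : Injective _≡_ _≡_ col
  col-inj = Injection.injective (↔⇒↣ cols)

  M : Matrix m n
  M r c = incidence (col c) (row r)

  simple : Simple M
  simple c c' same = col-inj (separated (col c) (col c') λ x →
    subst (λ y → incidence (col c) y ≡ incidence (col c') y)
          (Inverse.strictlyInverseˡ rows x) (same (Inverse.from rows x)))

  noConfig : ¬ HasConfig M F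
  noConfig (f , g , f-inj , g-inj , copy) =
    avoids (λ r → row (f r)) (λ c → col (g c))
           (λ e → f-inj (row-inj e)) (λ e → g-inj (col-inj e)) copy

-- The field GF(4) = {0, 1, ω, ω²}, with ω² = ω + 1

GF4 : Set
GF4 = Fin 4

pattern 𝟎 = zero
pattern 𝟏 = suc zero
pattern ω = suc (suc zero)
pattern ω² = suc (suc (suc zero))

infixl 6 _⊕_
infixl 7 _⊗_

_⊕_ : GF4 → GF4 → GF4
𝟎 ⊕ y = y
𝟏 ⊕ 𝟎 = 𝟏
𝟏 ⊕ 𝟏 = 𝟎
𝟏 ⊕ ω = ω²
𝟏 ⊕ ω² = ω
ω ⊕ 𝟎 = ω
ω ⊕ 𝟏 = ω²
ω ⊕ ω = 𝟎
ω ⊕ ω² = 𝟏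
ω² ⊕ 𝟎 = ω²
ω² ⊕ 𝟏 = ω
ω² ⊕ ω = 𝟏
ω² ⊕ ω² = 𝟎

_⊗_ : GF4 → GF4 → GF4
𝟎 ⊗ y = 𝟎
𝟏 ⊗ y = y
ω ⊗ 𝟎 = 𝟎
ω ⊗ 𝟏 = ω
ω ⊗ ω = ω²
ω ⊗ ω² = 𝟏
ω² ⊗ 𝟎 = 𝟎
ω² ⊗ 𝟏 = ω²
ω² ⊗ ω = 𝟏
ω² ⊗ ω² = ω

opaque
  affine-determined : ∀ s s' p v p' v' → ¬ s ≡ s' →
    p ⊕ s ⊗ v ≡ p' ⊕ s ⊗ v' → p ⊕ s' ⊗ v ≡ p' ⊕ s' ⊗ v' → p ≡ p' × v ≡ v'
  affine-determined = from-yes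
    (all? λ s → all? λ s' → all? λ p → all? λ v → all? λ p' → all? λ v' →
      ¬? (s ≟ s') →-dec (p ⊕ s ⊗ v ≟ p' ⊕ s ⊗ v') →-dec
      (p ⊕ s' ⊗ v ≟ p' ⊕ s' ⊗ v') →-dec (p ≟ p' ×-dec v ≟ v'))

opaque
  fourth-element : ∀ (a b c : GF4) → ¬ a ≡ b → ¬ a ≡ c → ¬ b ≡ c →
    ∃ λ d → ∀ x → x ≡ a ⊎ x ≡ b ⊎ x ≡ c ⊎ x ≡ d
  fourth-element = from-yes
    (all? {4} λ a → all? {4} λ b → all? {4} λ c →
      ¬? (a ≟ b) →-dec ¬? (a ≟ c) →-dec ¬? (b ≟ c) →-dec
      any? {4} λ d → all? {4} λ x → x ≟ a ⊎-dec x ≟ b ⊎-dec x ≟ c ⊎-dec x ≟ d)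

-- Points and lines of AG(j,4)

Point : ℕ → Set
Point j = Vec GF4 j

affine : ∀ {j} → Point j → GF4 → Point j → Point j
affine p s v = zipWith (λ x y → x ⊕ s ⊗ y) p v

affine-determinedᵛ : ∀ {j} {s s'} (p v p' v' : Point j) → ¬ s ≡ s' →
  affine p s v ≡ affine p' s v' → affine p s' v ≡ affine p' s' v' →
  p ≡ p' × v ≡ v'
affine-determinedᵛ [] [] [] [] _ _ _ = refl , refl
affine-determinedᵛ {s = s} {s'} (x ∷ p) (y ∷ v) (x' ∷ p') (y' ∷ v') s≢s' e e'
  with affine-determined s s' x y x' y' s≢s' (∷-injectiveˡ e) (∷-injectiveˡ e')
     | affine-determinedᵛ p v p' v' s≢s' (∷-injectiveʳ e) (∷-injectiveʳ e')
... | refl , refl | refl , refl = refl , refl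

-- Lines of AG(suc j,4) in normal form: either a line of AG(j,4) placed in a
-- hyperplane x₀ = t, or a line transversal to these hyperplanes, which is
-- parametrised by its first coordinate as s ↦ (s , p + s v).  Each line has
-- exactly one representative.
Line : ℕ → Set
Line zero = ⊥
Line (suc j) = (GF4 × Line j) ⊎ (Point j × Point j)

pattern inHyperplane t ℓ = inj₁ (t , ℓ)
pattern transversal p v = inj₂ (p , v)

pt : ∀ {j} → Line j → GF4 → Point j
pt {suc j} (inHyperplane t ℓ) s = t ∷ pt ℓ s
pt {suc j} (transversal p v) s = s ∷ affine p s v

pt-injective : ∀ {j} (ℓ : Line j) {s s'} → pt ℓ s ≡ pt ℓ s' → s ≡ s'
pt-injective {suc j} (inHyperplane t ℓ) e = pt-injective ℓ (∷-injectiveʳ e)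
pt-injective {suc j} (transversal p v) e = ∷-injectiveˡ e

line-unique : ∀ {j} (ℓ ℓ' : Line j) {s s' u u'} → ¬ s ≡ s' →
  pt ℓ s ≡ pt ℓ' u → pt ℓ s' ≡ pt ℓ' u' → ℓ ≡ ℓ'
line-unique {suc j} (inHyperplane t ℓ) (inHyperplane t' ℓ') s≢s' e e'
  with ∷-injectiveˡ e | line-unique ℓ ℓ' s≢s' (∷-injectiveʳ e) (∷-injectiveʳ e')
... | refl | refl = refl
line-unique {suc j} (inHyperplane t ℓ) (transversal p v) s≢s' e e'
  with ∷-injectiveˡ e | ∷-injectiveˡ e'
... | refl | refl = ⊥-elim (s≢s' (pt-injective (inHyperplane t ℓ) (trans e (sym e'))))
line-unique {suc j} (transversal p v) (inHyperplane t ℓ) s≢s' e e'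
  with ∷-injectiveˡ e | ∷-injectiveˡ e'
... | refl | refl = ⊥-elim (s≢s' refl)
line-unique {suc j} (transversal p v) (transversal p' v') s≢s' e e'
  with ∷-injectiveˡ e | ∷-injectiveˡ e'
... | refl | refl with affine-determinedᵛ p v p' v' s≢s' (∷-injectiveʳ e) (∷-injectiveʳ e')
... | refl , refl = refl

bigSubsets : Vec (Vec Bool 4) 11
bigSubsets =
    (true  ∷ true  ∷ false ∷ false ∷ [])
  ∷ (true  ∷ false ∷ true  ∷ false ∷ [])
  ∷ (true  ∷ false ∷ false ∷ true  ∷ [])
  ∷ (false ∷ true  ∷ true  ∷ false ∷ [])
  ∷ (false ∷ true  ∷ false ∷ true  ∷ [])
  ∷ (false ∷ false ∷ true  ∷ true  ∷ [])
  ∷ (false ∷ true  ∷ true  ∷ true  ∷ [])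
  ∷ (true  ∷ false ∷ true  ∷ true  ∷ [])
  ∷ (true  ∷ true  ∷ false ∷ true  ∷ [])
  ∷ (true  ∷ true  ∷ true  ∷ false ∷ [])
  ∷ (true  ∷ true  ∷ true  ∷ true  ∷ [])
  ∷ []

_∈ˢ_ : GF4 → Fin 11 → Bool
s ∈ˢ i = lookup (lookup bigSubsets i) s

opaque
  subset-ext : ∀ i i' → (∀ s → s ∈ˢ i ≡ s ∈ˢ i') → i ≡ i'
  subset-ext = from-yes
    (all? λ i → all? λ i' → all? (λ s → s ∈ˢ i Bool.≟ s ∈ˢ i') →-dec i ≟ i')

opaque
  two-elements : ∀ i → ∃₂ λ s s' → ¬ s ≡ s' × s ∈ˢ i ≡ true × s' ∈ˢ i ≡ true
  two-elements = from-yes (all? λ i → any? λ s → any? λ s' →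
    ¬? (s ≟ s') ×-dec s ∈ˢ i Bool.≟ true ×-dec s' ∈ˢ i Bool.≟ true)

Separates : GF4 → GF4 → GF4 → Fin 11 → Set
Separates a b c i = a ∈ˢ i ≡ true × b ∈ˢ i ≡ true × c ∈ˢ i ≡ false

separating-determined : ∀ {a b c d} → (∀ x → x ≡ a ⊎ x ≡ b ⊎ x ≡ c ⊎ x ≡ d) →
  ∀ {i i'} → Separates a b c i → Separates a b c i' → d ∈ˢ i ≡ d ∈ˢ i' → i ≡ i'
separating-determined {a} {b} {c} {d} cover {i} {i'} (ai , bi , ci) (ai' , bi' , ci') di =
  subset-ext i i' λ x → agree (cover x)
  where
  agree : ∀ {x} → x ≡ a ⊎ x ≡ b ⊎ x ≡ c ⊎ x ≡ d → x ∈ˢ i ≡ x ∈ˢ i'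
  agree (inj₁ refl) = trans ai (sym ai')
  agree (inj₂ (inj₁ refl)) = trans bi (sym bi')
  agree (inj₂ (inj₂ (inj₁ refl))) = trans ci (sym ci')
  agree (inj₂ (inj₂ (inj₂ refl))) = di

pigeonhole-Bool : ∀ (x y z : Bool) → x ≡ y ⊎ x ≡ z ⊎ y ≡ z
pigeonhole-Bool false false _ = inj₁ refl
pigeonhole-Bool true true _ = inj₁ refl
pigeonhole-Bool false true false = inj₂ (inj₁ refl)
pigeonhole-Bool true false true = inj₂ (inj₁ refl)
pigeonhole-Bool false true true = inj₂ (inj₂ refl)
pigeonhole-Bool true false false = inj₂ (inj₂ refl)

at-most-two-separating : ∀ {a b c} → ¬ a ≡ b → ¬ a ≡ c → ¬ b ≡ c → ∀ {i₁ i₂ i₃} →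
  Separates a b c i₁ → Separates a b c i₂ → Separates a b c i₃ →
  i₁ ≡ i₂ ⊎ i₁ ≡ i₃ ⊎ i₂ ≡ i₃
at-most-two-separating a≢b a≢c b≢c {i₁} {i₂} {i₃} sep₁ sep₂ sep₃
  with fourth-element _ _ _ a≢b a≢c b≢c
... | d , cover with pigeonhole-Bool (d ∈ˢ i₁) (d ∈ˢ i₂) (d ∈ˢ i₃)
... | inj₁ e = inj₁ (separating-determined cover sep₁ sep₂ e)
... | inj₂ (inj₁ e) = inj₂ (inj₁ (separating-determined cover sep₁ sep₃ e))
... | inj₂ (inj₂ e) = inj₂ (inj₂ (separating-determined cover sep₂ sep₃ e))

-- The column family

Column : ℕ → Set
Column j = ⊤ ⊎ (Point j ⊎ (Line j × Fin 11))

pattern emptySet = inj₁ tt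
pattern singleton y = inj₂ (inj₁ y)
pattern lineSubset ℓ i = inj₂ (inj₂ (ℓ , i))

infix 4 _∈_ _∈?_ _⊆_

_∈_ : ∀ {j} → Point j → Column j → Set
x ∈ emptySet = ⊥
x ∈ singleton y = x ≡ y
x ∈ lineSubset ℓ i = ∃ λ s → s ∈ˢ i ≡ true × pt ℓ s ≡ x

_∈?_ : ∀ {j} (x : Point j) (X : Column j) → Dec (x ∈ X)
x ∈? emptySet = no λ ()
x ∈? singleton y = ≡-dec _≟_ x y
x ∈? lineSubset ℓ i = any? λ s → s ∈ˢ i Bool.≟ true ×-dec ≡-dec _≟_ (pt ℓ s) x

_⊆_ : ∀ {j} → Column j → Column j → Set
X ⊆ Y = ∀ {x} → x ∈ X → x ∈ Y

pt∈lineSubset : ∀ {j} (ℓ : Line j) i {s} → pt ℓ s ∈ lineSubset ℓ i → s ∈ˢ i ≡ true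
pt∈lineSubset ℓ i (s' , s'∈i , e) with pt-injective ℓ e
... | refl = s'∈i

two-points : ∀ {j} (ℓ : Line j) i →
  ∃₂ λ s s' → ¬ s ≡ s' × pt ℓ s ∈ lineSubset ℓ i × pt ℓ s' ∈ lineSubset ℓ i
two-points ℓ i with two-elements i
... | s , s' , s≢s' , s∈i , s'∈i = s , s' , s≢s' , (s , s∈i , refl) , (s' , s'∈i , refl)

spanning : ∀ {j} {x y : Point j} (X : Column j) → ¬ x ≡ y → x ∈ X → y ∈ X →
  ∃₂ λ ℓ i → X ≡ lineSubset ℓ i
spanning (singleton z) x≢y refl refl = ⊥-elim (x≢y refl)
spanning (lineSubset ℓ i) _ _ _ = ℓ , i , refl

within-line : ∀ {j} (ℓ : Line j) {s s'} (X : Column j) → ¬ s ≡ s' →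
  pt ℓ s ∈ X → pt ℓ s' ∈ X → ∃ λ i → X ≡ lineSubset ℓ i
within-line ℓ (singleton z) s≢s' refl e = ⊥-elim (s≢s' (pt-injective ℓ (sym e)))
within-line ℓ (lineSubset ℓ' i) s≢s' (_ , _ , e) (_ , _ , e')
  with line-unique ℓ ℓ' s≢s' (sym e) (sym e')
... | refl = i , refl

column-ext : ∀ {j} (X Y : Column j) → X ⊆ Y → Y ⊆ X → X ≡ Y
column-ext emptySet emptySet _ _ = refl
column-ext emptySet (singleton y) _ Y⊆X = ⊥-elim (Y⊆X refl)
column-ext emptySet (lineSubset ℓ i) _ Y⊆X with two-points ℓ i
... | _ , _ , _ , p , _ = ⊥-elim (Y⊆X p)
column-ext (singleton x) emptySet X⊆Y _ = ⊥-elim (X⊆Y refl)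
column-ext (singleton x) (singleton y) X⊆Y _ = cong singleton (X⊆Y refl)
column-ext (singleton x) (lineSubset ℓ i) _ Y⊆X with two-points ℓ i
... | _ , _ , s≢s' , p , p' = ⊥-elim (s≢s' (pt-injective ℓ (trans (Y⊆X p) (sym (Y⊆X p')))))
column-ext (lineSubset ℓ i) emptySet X⊆Y _ with two-points ℓ i
... | _ , _ , _ , p , _ = ⊥-elim (X⊆Y p)
column-ext (lineSubset ℓ i) (singleton y) X⊆Y _ with two-points ℓ i
... | _ , _ , s≢s' , p , p' = ⊥-elim (s≢s' (pt-injective ℓ (trans (X⊆Y p) (sym (X⊆Y p')))))
column-ext (lineSubset ℓ i) (lineSubset ℓ' i') X⊆Y Y⊆X with two-points ℓ i
... | _ , _ , s≢s' , p , p' with within-line ℓ (lineSubset ℓ' i') s≢s' (X⊆Y p) (X⊆Y p')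
... | _ , refl = cong (lineSubset ℓ) (subset-ext i i' λ s → Bool.⇔→≡ (mk⇔
        (λ s∈i → pt∈lineSubset ℓ i' (X⊆Y (s , s∈i , refl)))
        (λ s∈i' → pt∈lineSubset ℓ i (Y⊆X (s , s∈i' , refl)))))

separating-column : ∀ {j} (ℓ : Line j) {s s' s''} (X : Column j) → ¬ s ≡ s' →
  pt ℓ s ∈ X → pt ℓ s' ∈ X → ¬ pt ℓ s'' ∈ X →
  ∃ λ i → X ≡ lineSubset ℓ i × Separates s s' s'' i
separating-column ℓ {s'' = s''} X s≢s' p p' p'' with within-line ℓ X s≢s' p p'
... | i , refl =
  i , refl , pt∈lineSubset ℓ i p , pt∈lineSubset ℓ i p' , Bool.¬-not λ e → p'' (s'' , e , refl)

incidence : ∀ {j} → Column j → Point j → Bool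
incidence X x = does (x ∈? X)

witness : ∀ {P : Set} (d : Dec P) → does d ≡ true → P
witness (yes p) _ = p
witness (no _) ()

refutation : ∀ {P : Set} (d : Dec P) → does d ≡ false → ¬ P
refutation (yes _) ()
refutation (no ¬p) _ = ¬p

incidence-separates : ∀ {j} (X Y : Column j) →
  (∀ x → incidence X x ≡ incidence Y x) → X ≡ Y
incidence-separates X Y same = column-ext X Y
  (λ {x} x∈X → witness (x ∈? Y) (trans (sym (same x)) (dec-true (x ∈? X) x∈X)))
  (λ {x} x∈Y → witness (x ∈? X) (trans (same x) (dec-true (x ∈? Y) x∈Y)))

pattern r₀ = zero
pattern r₁ = suc zero
pattern r₂ = suc (suc zero)
pattern c₀ = zero
pattern c₁ = suc zero
pattern c₂ = suc (suc zero)
pattern c₃ = suc (suc (suc zero))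

-- The rows of a copy of A share
-- the column c₀, so they lie on one line ℓ; the columns c₁, c₂, c₃ are then
-- subsets of ℓ separating the first two rows from the third, and two of them
-- coincide.
avoids-A : ∀ {j} (f : Fin 3 → Point j) (g : Fin 4 → Column j) →
  Injective _≡_ _≡_ f → Injective _≡_ _≡_ g →
  (∀ r c → incidence (g c) (f r) ≡ A r c) → ⊥
avoids-A {j} f g f-inj g-inj copy =
  two-coincide (at-most-two-separating
    (params-distinct λ ()) (params-distinct λ ()) (params-distinct λ ())
    (separates sep₁) (separates sep₂) (separates sep₃))
  where
  ∈-copy : ∀ r c → A r c ≡ true → f r ∈ g c
  ∈-copy r c e = witness (f r ∈? g c) (trans (copy r c) e)

  ∉-copy : ∀ r c → A r c ≡ false → ¬ f r ∈ g c
  ∉-copy r c e = refutation (f r ∈? g c) (trans (copy r c) e)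

  first-column : ∃₂ λ ℓ i → g c₀ ≡ lineSubset ℓ i
  first-column = spanning (g c₀) (λ e → r₀≢r₁ (f-inj e)) (∈-copy r₀ c₀ refl) (∈-copy r₁ c₀ refl)
    where
    r₀≢r₁ : ¬ r₀ ≡ r₁
    r₀≢r₁ ()

  ℓ : Line j
  ℓ = proj₁ first-column

  A-c₀ : ∀ r → A r c₀ ≡ true
  A-c₀ r₀ = refl
  A-c₀ r₁ = refl
  A-c₀ r₂ = refl

  on-ℓ : ∀ r → ∃ λ s → pt ℓ s ≡ f r
  on-ℓ r with subst (f r ∈_) (proj₂ (proj₂ first-column)) (∈-copy r c₀ (A-c₀ r))
  ... | s , _ , e = s , e

  param : Fin 3 → GF4
  param r = proj₁ (on-ℓ r)

  params-distinct : ∀ {r r'} → ¬ r ≡ r' → ¬ param r ≡ param r'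
  params-distinct r≢r' e =
    r≢r' (f-inj (trans (sym (proj₂ (on-ℓ _))) (trans (cong (pt ℓ) e) (proj₂ (on-ℓ _)))))

  at-param : ∀ r c → f r ∈ g c → pt ℓ (param r) ∈ g c
  at-param r c = subst (_∈ g c) (sym (proj₂ (on-ℓ r)))

  Separating : Fin 4 → Set
  Separating c = ∃ λ i → g c ≡ lineSubset ℓ i × Separates (param r₀) (param r₁) (param r₂) i

  separates : ∀ {c} (S : Separating c) → Separates (param r₀) (param r₁) (param r₂) (proj₁ S)
  separates (_ , _ , sep) = sep

  separating : ∀ c → A r₀ c ≡ true → A r₁ c ≡ true → A r₂ c ≡ false → Separating c
  separating c a b c' = separating-column ℓ (g c) (params-distinct λ ())
    (at-param r₀ c (∈-copy r₀ c a)) (at-param r₁ c (∈-copy r₁ c b))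
    (∉-copy r₂ c c' ∘ subst (_∈ g c) (proj₂ (on-ℓ r₂)))

  sep₁ : Separating c₁
  sep₁ = separating c₁ refl refl refl
  sep₂ : Separating c₂
  sep₂ = separating c₂ refl refl refl
  sep₃ : Separating c₃
  sep₃ = separating c₃ refl refl refl

  apart : ∀ {c c'} → ¬ c ≡ c' → (S : Separating c) (S' : Separating c') → ¬ proj₁ S ≡ proj₁ S'
  apart c≢c' (_ , e , _) (_ , e' , _) refl = c≢c' (g-inj (trans e (sym e')))

  two-coincide : proj₁ sep₁ ≡ proj₁ sep₂ ⊎ proj₁ sep₁ ≡ proj₁ sep₃ ⊎ proj₁ sep₂ ≡ proj₁ sep₃ → ⊥
  two-coincide (inj₁ e) = apart (λ ()) sep₁ sep₂ e
  two-coincide (inj₂ (inj₁ e)) = apart (λ ()) sep₁ sep₃ e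
  two-coincide (inj₂ (inj₂ e)) = apart (λ ()) sep₂ sep₃ e

cons↔ : ∀ {X : Set} {n} → (X × Vec X n) ↔ Vec X (suc n)
cons↔ = mk↔ₛ′ (λ (x , xs) → x ∷ xs) (λ { (x ∷ xs) → x , xs }) (λ { (x ∷ xs) → refl }) (λ { (x , xs) → refl })

nil↔ : ∀ {X : Set} → ⊤ ↔ Vec X 0
nil↔ = mk↔ₛ′ (λ _ → []) (λ _ → tt) (λ { [] → refl }) (λ _ → refl)

points : ∀ j → Fin (4 ^ j) ↔ Point j
points zero = ↔-trans 1↔⊤ nil↔
points (suc j) = ↔-trans *↔× (↔-trans (↔-refl ×-↔ points j) cons↔)

-- The number of lines of AG(j,4), following the normal form of Line.
lineCount : ℕ → ℕ
lineCount zero = 0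
lineCount (suc j) = 4 * lineCount j + 4 ^ j * 4 ^ j

lines : ∀ j → Fin (lineCount j) ↔ Line j
lines zero = 0↔⊥
lines (suc j) = ↔-trans +↔⊎
  (↔-trans *↔× (↔-refl ×-↔ lines j) ⊎-↔ ↔-trans *↔× (points j ×-↔ points j))

columnCount : ℕ → ℕ
columnCount j = 1 + (4 ^ j + lineCount j * 11)

columns : ∀ j → Fin (columnCount j) ↔ Column j
columns j = ↔-trans +↔⊎ (1↔⊤ ⊎-↔ ↔-trans +↔⊎ (points j ⊎-↔ ↔-trans *↔× (lines j ×-↔ ↔-refl)))

columns-lowerBound : ∀ j {N} → IsForb (4 ^ j) A N → columnCount j ≤ N
columns-lowerBound j = forb-lowerBound A (points j) (columns j) incidence incidence-separates avoids-A

choose-two : ∀ n → 2 * (n C 2) + n ≡ n * n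
choose-two zero = refl
choose-two (suc n) = begin
  2 * (suc n C 2) + suc n        ≡⟨ cong (λ c → 2 * c + suc n) (sym (nCk+nC[k+1]≡[n+1]C[k+1] n 1)) ⟩
  2 * (n C 1 + n C 2) + suc n    ≡⟨ cong (λ c → 2 * (c + n C 2) + suc n) (nC1≡n n) ⟩
  2 * (n + n C 2) + suc n        ≡⟨ regroup n (n C 2) ⟩
  (2 * (n C 2) + n) + (1 + 2 * n) ≡⟨ cong (_+ (1 + 2 * n)) (choose-two n) ⟩
  n * n + (1 + 2 * n)            ≡⟨ square-suc n ⟩
  suc n * suc n                  ∎
  where
  open ≡-Reasoning
  regroup : ∀ n c → 2 * (n + c) + suc n ≡ (2 * c + n) + (1 + 2 * n)
  regroup = solve-∀
  square-suc : ∀ n → n * n + (1 + 2 * n) ≡ suc n * suc n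
  square-suc = solve-∀

lineCount-closed : ∀ j → 12 * lineCount j + 4 ^ j ≡ 4 ^ j * 4 ^ j
lineCount-closed zero = refl
lineCount-closed (suc j) = begin
  12 * (4 * b + q * q) + 4 * q      ≡⟨ expand b q ⟩
  4 * (12 * b + q) + 12 * (q * q)   ≡⟨ cong (λ x → 4 * x + 12 * (q * q)) (lineCount-closed j) ⟩
  4 * (q * q) + 12 * (q * q)        ≡⟨ collect q ⟩
  (4 * q) * (4 * q)                 ∎
  where
  open ≡-Reasoning
  b q : ℕ
  b = lineCount j
  q = 4 ^ j
  expand : ∀ b q → 12 * (4 * b + q * q) + 4 * q ≡ 4 * (12 * b + q) + 12 * (q * q)
  expand = solve-∀
  collect : ∀ q → 4 * (q * q) + 12 * (q * q) ≡ (4 * q) * (4 * q)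
  collect = solve-∀

-- Each line covers C(4,2) = 6 of the C(m,2) pairs of points.
six-lineCount : ∀ j → 6 * lineCount j ≡ (4 ^ j) C 2
six-lineCount j = *-cancelˡ-≡ _ _ 2 (+-cancelʳ-≡ (4 ^ j) _ _ (begin
  2 * (6 * lineCount j) + 4 ^ j  ≡⟨ cong (_+ 4 ^ j) (sym (*-assoc 2 6 (lineCount j))) ⟩
  12 * lineCount j + 4 ^ j       ≡⟨ lineCount-closed j ⟩
  4 ^ j * 4 ^ j                  ≡⟨ sym (choose-two (4 ^ j)) ⟩
  2 * ((4 ^ j) C 2) + 4 ^ j      ∎))
  where open ≡-Reasoning

lineCount-increasing : ∀ j → suc (lineCount j) ≤ lineCount (suc j)
lineCount-increasing j = begin
  suc b                  ≡⟨ +-comm 1 b ⟩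
  b + 1                  ≤⟨ +-mono-≤ (m≤m+n b (3 * b)) (*-mono-≤ (m^n>0 4 j) (m^n>0 4 j)) ⟩
  4 * b + 4 ^ j * 4 ^ j  ∎
  where
  open ≤-Reasoning
  b : ℕ
  b = lineCount j

pow≤lineCount : ∀ j → 4 ^ j ≤ lineCount (suc j)
pow≤lineCount j = begin
  4 ^ j                  ≡⟨ sym (*-identityʳ (4 ^ j)) ⟩
  4 ^ j * 1              ≤⟨ *-monoʳ-≤ (4 ^ j) (m^n>0 4 j) ⟩
  4 ^ j * 4 ^ j          ≤⟨ m≤n+m _ (4 * lineCount j) ⟩
  lineCount (suc j)      ∎
  where open ≤-Reasoning

-- If dimension j+1 has exactly k lines, dimension j+2 has
-- more, and 4^(j+2) ≤ 16 · lineCount (j+1) = 16k points.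
dimension : ∀ k → ∃ λ j → suc k ≤ lineCount (suc j) × 4 ^ suc j ≤ 16 * suc k
dimension zero = 0 , ≤-refl , from-yes (4 ≤? 16)
dimension (suc k) with dimension k
... | j , k<b , small with suc (suc k) ≤? lineCount (suc j)
...   | yes fits = j , fits , ≤-trans small (*-monoʳ-≤ 16 (n≤1+n (suc k)))
...   | no ¬fits = suc j , grows , small'
  where
  exact : lineCount (suc j) ≡ suc k
  exact = ≤-antisym (s≤s⁻¹ (≰⇒> ¬fits)) k<b
  grows : suc (suc k) ≤ lineCount (suc (suc j))
  grows = subst (λ b → suc b ≤ lineCount (suc (suc j))) exact (lineCount-increasing (suc j))
  small' : 4 ^ suc (suc j) ≤ 16 * suc (suc k)
  small' = begin
    4 * (4 * 4 ^ j)          ≡⟨ sym (*-assoc 4 4 (4 ^ j)) ⟩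
    16 * 4 ^ j               ≤⟨ *-monoʳ-≤ 16 (pow≤lineCount j) ⟩
    16 * lineCount (suc j)   ≡⟨ cong (16 *_) exact ⟩
    16 * suc k               ≤⟨ *-monoʳ-≤ 16 (n≤1+n (suc k)) ⟩
    16 * suc (suc k)         ∎
    where open ≤-Reasoning

target-bound : ∀ m b k N → 6 * b ≡ m C 2 → k ≤ b → 1 + (m + b * 11) ≤ N →
  5 * (m C 2) + 3 * ((m C 1) + (m C 0) + k) ≤ 3 * N
target-bound m b k N six k≤b enough = begin
  5 * (m C 2) + 3 * (m C 1 + m C 0 + k)  ≡⟨ cong₂ (λ c c₁ → 5 * c + 3 * (c₁ + 1 + k)) (sym six) (nC1≡n m) ⟩
  5 * (6 * b) + 3 * (m + 1 + k)          ≡⟨ gather m b k ⟩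
  3 * (1 + m + 10 * b + k)               ≤⟨ *-monoʳ-≤ 3 (+-monoʳ-≤ (1 + m + 10 * b) k≤b) ⟩
  3 * (1 + m + 10 * b + b)               ≡⟨ cong (3 *_) (count m b) ⟩
  3 * (1 + (m + b * 11))                 ≤⟨ *-monoʳ-≤ 3 enough ⟩
  3 * N                                  ∎
  where
  open ≤-Reasoning
  gather : ∀ m b k → 5 * (6 * b) + 3 * (m + 1 + k) ≡ 3 * (1 + m + 10 * b + k)
  gather = solve-∀
  count : ∀ m b → 1 + m + 10 * b + b ≡ 1 + (m + b * 11)
  count = solve-∀

mainTheorem3 : ∀ (k : ℕ) → 1 ≤ k →
    Σ ℕ λ m → m ≤ 64 * k + 1 ×
      (∀ N → IsForb m A N →
        5 * (m C 2) + 3 * ((m C 1) + (m C 0) + k) ≤ 3 * N)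
mainTheorem3 (suc k) _ with dimension k
... | j , k≤b , small = 4 ^ suc j , in-range , λ N forb →
  target-bound (4 ^ suc j) (lineCount (suc j)) (suc k) N
    (six-lineCount (suc j)) k≤b (columns-lowerBound (suc j) forb)
  where
  in-range : 4 ^ suc j ≤ 64 * suc k + 1
  in-range = ≤-trans small (≤-trans (*-monoˡ-≤ (suc k) (from-yes (16 ≤? 64))) (m≤m+n _ 1))
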